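{- Let $P$ be a finite poset, $\ell$ a positive integer, $u,v:P\to\{0,\ldots,\ell\}$ as in the context, and let $R$ be a restriction function on $P$ that is consistent with respect to $P\times[\ell]^v_u$. Define $\hat R$ by $$\hat R(p)=R(p)\cup\Big\{\min\textstyle\bigcup_{q\in P}R(q)-\tilde h(p),\ \max\bigcup_{q\in P}R(q)+h(p)\Big\}.$$ Then $\hat R$ is consistent on $P$, i.e. for every $p\in P$ and every $k\in\hat R(p)$ there is a map $f:P\to\mathbb Z$ with $f(p_1)<f(p_2)$ whenever $p_1<_P p_2$, $f(x)\in \hat R(x)$ for all $x\in P$, and $f(p)=k$.
   Context: $P$ is a finite poset, $[\ell]$ the chain $1<\cdots<\ell$, and $P\times[\ell]$ has the product order. Let $u,v:P\to\{0,1,\ldots,\ell\}$ satisfy $u(p)+v(p)\le\ell$ for all $p$, and $v(p_1)\le v(p_2)$, $u(p_1)\ge u(p_2)$ whenever $p_1\le_P p_2$. Put $P\times[\ell]^v_u=\{(p,i)\in P\times[\ell]: u(p)<i<\ell+1-v(p)\}$. A restriction function on $P$ is a map $R$ from $P$ to nonempty finite subsets of $\mathbb Z$. A $P$-strict labeling of $P\times[\ell]^v_u$ with restriction function $R$ is a map $f:P\times[\ell]^v_u\to\mathbb Z$ such that (for elements of $P\times[\ell]^v_u$) $f(p_1,i)<f(p_2,i)$ whenever $p_1<_Pp_2$, $f(p,i_1)\le f(p,i_2)$ whenever $i_1\le i_2$, and $f(p,i)\in R(p)$. $R$ is consistent with respect to $P\times[\ell]^v_u$ if for every $p\in P$ and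 $k\in R(p)$ there is such a labeling $f$ and some $(p,i)\in P\times[\ell]^v_u$ with $f(p,i)=k$. For $p\in P$, $h(p)$ is the maximum number of elements of a chain of $P$ whose largest element is $p$, and $\tilde h(p)$ is the maximum number of elements of a chain of $P$ whose smallest element is $p$. -}

module Defs where

open import Data.Nat using (ℕ; _<_; _≤_; _+_)
open import Data.Integer as ℤ using (ℤ)
open import Data.Fin using (Fin)
open import Data.List using (List; []; _∷_; head; last; length)
open import Data.List.Membership.Propositional using (_∈_)
open import Data.List.Relation.Unary.Linked using (Linked)
open import Data.Maybe using (just)
open import Data.Product using (Σ; _×_; ∃; ∃-syntax)
open import Relation.Binary.PropositionalEquality using (_≡_; _≢_)

-- A finite poset P is modelled as Fin n with a partial order _≤P_ (w.r.t. ≡).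
-- Strict order induced by _≤P_.
Strict : ∀ {n} → (Fin n → Fin n → Set) → Fin n → Fin n → Set
Strict _≤P_ p q = p ≤P q × p ≢ q

-- A chain of P, written in increasing order (consecutive elements strictly related;
-- by transitivity every pair is comparable, and its size is the list length).
IsChain : ∀ {n} → (Fin n → Fin n → Set) → List (Fin n) → Set
IsChain _≤P_ c = Linked (Strict _≤P_) c

IsH : ∀ {n} → (Fin n → Fin n → Set) → Fin n → ℕ → Set
IsH _≤P_ p m =
  (∃[ c ] (IsChain _≤P_ c × last c ≡ just p × length c ≡ m)) ×
  (∀ c → IsChain _≤P_ c → last c ≡ just p → length c ≤ m)

IsH~ : ∀ {n} → (Fin n → Fin n → Set) → Fin n → ℕ → Set
IsH~ _≤P_ p m =
  (∃[ c ] (IsChain _≤P_ c × head c ≡ just p × length c ≡ m)) ×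
  (∀ c → IsChain _≤P_ c → head c ≡ just p → length c ≤ m)

IsMinUnion : ∀ {n} → (Fin n → List ℤ) → ℤ → Set
IsMinUnion R m = (∃[ q ] (m ∈ R q)) × (∀ q k → k ∈ R q → m ℤ.≤ k)

IsMaxUnion : ∀ {n} → (Fin n → List ℤ) → ℤ → Set
IsMaxUnion R M = (∃[ q ] (M ∈ R q)) × (∀ q k → k ∈ R q → k ℤ.≤ M)

-- (p , i) ∈ P × [ℓ]^v_u   iff   u(p) < i < ℓ + 1 - v(p)   (i.e. i + v(p) ≤ ℓ)
InDom : ∀ {n} → ℕ → (Fin n → ℕ) → (Fin n → ℕ) → Fin n → ℕ → Set
InDom ℓ u v p i = u p < i × i + v p ≤ ℓ

-- P-strict labeling of P × [ℓ]^v_u with restriction function R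
-- (f is given on all of Fin n × ℕ, but only its values on the domain matter).
IsPStrictLabeling : ∀ {n} → (Fin n → Fin n → Set) → ℕ → (Fin n → ℕ) → (Fin n → ℕ) →
                    (Fin n → List ℤ) → (Fin n → ℕ → ℤ) → Set
IsPStrictLabeling _≤P_ ℓ u v R f =
  (∀ p₁ p₂ i → InDom ℓ u v p₁ i → InDom ℓ u v p₂ i →
     Strict _≤P_ p₁ p₂ → f p₁ i ℤ.< f p₂ i) ×
  (∀ p i₁ i₂ → InDom ℓ u v p i₁ → InDom ℓ u v p i₂ → i₁ ≤ i₂ → f p i₁ ℤ.≤ f p i₂) ×
  (∀ p i → InDom ℓ u v p i → f p i ∈ R p)

IsConsistentPL : ∀ {n} → (Fin n → Fin n → Set) → ℕ → (Fin n → ℕ) → (Fin n → ℕ) →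
                 (Fin n → List ℤ) → Set
IsConsistentPL _≤P_ ℓ u v R =
  ∀ p k → k ∈ R p →
    ∃[ f ] (IsPStrictLabeling _≤P_ ℓ u v R f × ∃[ i ] (InDom ℓ u v p i × f p i ≡ k))

IsConsistentP : ∀ {n : ℕ} → (Fin n → Fin n → Set) → (Fin n → List ℤ) → Set
IsConsistentP {n} _≤P_ R =
  ∀ p k → k ∈ R p →
    Σ (Fin n → ℤ) λ f → ((∀ p₁ p₂ → Strict _≤P_ p₁ p₂ → f p₁ ℤ.< f p₂) ×
            (∀ x → f x ∈ R x) × f p ≡ k)

Rhat : ∀ {n} → (Fin n → List ℤ) → ℤ → ℤ → (Fin n → ℕ) → (Fin n → ℕ) → Fin n → List ℤ
Rhat R m M h h~ p = (m ℤ.- ℤ.+ h~ p) ∷ (M ℤ.+ ℤ.+ h p) ∷ R p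

{-# OPTIONS --safe #-}
module Submission where

open import Defs
open import Data.Nat using (ℕ; _<_; _≤_; _+_)
open import Data.Integer using (ℤ)
open import Data.Fin using (Fin)
open import Data.List using (List; [])
open import Relation.Binary.PropositionalEquality using (_≡_; _≢_)
open import Relation.Binary.Structures using (IsPartialOrder)

import Data.Nat as ℕ
import Data.Nat.Properties as ℕ
import Data.Integer as ℤ
import Data.Integer.Properties as ℤ
open import Data.Empty using (⊥; ⊥-elim)
open import Data.List using (_∷_; _∷ʳ_; length; last)
open import Data.List.Properties using (length-++)
open import Data.List.Membership.Propositional using (_∈_)
open import Data.List.Relation.Unary.Any using (here; there)
open import Data.List.Relation.Unary.Linked using ([-]; _∷_)
open import Data.List.Relation.Unary.Linked.Properties using (++⁺)
open import Data.Maybe using (just)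
open import Data.Maybe.Relation.Binary.Connected as Connected using (Connected)
open import Data.Product using (_,_; proj₁; proj₂)
open import Relation.Nullary using (yes; no)
open import Relation.Binary.PropositionalEquality using (refl; sym; trans; subst)

-- The two new values are realised by the labelings x ↦ m − h̃(x) and
-- x ↦ M + h(x), which are strict because h̃ strictly decreases and h strictly
-- increases along P. For an old value k = g(p, i) of a labeling g of P × [ℓ]^v_u,
-- take the slice x ↦ g(x, i) where (x, i) lies in the domain, m − h̃(x) where x lies
-- below the slice (i ≤ u(x)) and M + h(x) where it lies above it (ℓ < i + v(x)).
-- As u is antitone and v monotone, going up in P never moves from the slice to
-- below it, nor from above it back into it; and the three ranges of values are
-- ordered, since m − h̃ < m ≤ R(x) ≤ M < M + h.

i-m<i-n : ∀ (i : ℤ) {m n : ℕ} → n < m → i ℤ.- ℤ.+ m ℤ.< i ℤ.- ℤ.+ n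
i-m<i-n i n<m = ℤ.+-monoʳ-< i (ℤ.neg-mono-< (ℤ.+<+ n<m))

i-n<i : ∀ (i : ℤ) {n : ℕ} → 1 ≤ n → i ℤ.- ℤ.+ n ℤ.< i
i-n<i i {n} 1≤n = subst (i ℤ.- ℤ.+ n ℤ.<_) (ℤ.+-identityʳ i) (i-m<i-n i 1≤n)

i+m<i+n : ∀ (i : ℤ) {m n : ℕ} → m < n → i ℤ.+ ℤ.+ m ℤ.< i ℤ.+ ℤ.+ n
i+m<i+n i m<n = ℤ.+-monoʳ-< i (ℤ.+<+ m<n)

i<i+n : ∀ (i : ℤ) {n : ℕ} → 1 ≤ n → i ℤ.< i ℤ.+ ℤ.+ n
i<i+n i {n} 1≤n = subst (ℤ._< i ℤ.+ ℤ.+ n) (ℤ.+-identityʳ i) (i+m<i+n i 1≤n)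

last-∷ʳ : ∀ {A : Set} (xs : List A) x → last (xs ∷ʳ x) ≡ just x
last-∷ʳ []           x = refl
last-∷ʳ (_ ∷ [])     x = refl
last-∷ʳ (_ ∷ y ∷ ys) x = last-∷ʳ (y ∷ ys) x

length-∷ʳ : ∀ {A : Set} (xs : List A) x → length (xs ∷ʳ x) ≡ ℕ.suc (length xs)
length-∷ʳ xs x = trans (length-++ xs) (ℕ.+-comm (length xs) 1)

StrictLabeling : ∀ {n} → (Fin n → Fin n → Set) → (Fin n → ℤ) → Set
StrictLabeling _≤P_ f = ∀ p₁ p₂ → Strict _≤P_ p₁ p₂ → f p₁ ℤ.< f p₂

module Heights {n : ℕ} {_≤P_ : Fin n → Fin n → Set} where

  IsChain-∷ʳ : ∀ {c x y} → IsChain _≤P_ c → last c ≡ just x → Strict _≤P_ x y →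
               IsChain _≤P_ (c ∷ʳ y)
  IsChain-∷ʳ {y = y} c-chain last-c x<y =
    ++⁺ c-chain (subst (λ z → Connected (Strict _≤P_) z (just y)) (sym last-c) (Connected.just x<y))
        [-]

  IsH⇒1≤ : ∀ {p k} → IsH _≤P_ p k → 1 ≤ k
  IsH⇒1≤ {p} (_ , maximal) = maximal (p ∷ []) [-] refl

  IsH~⇒1≤ : ∀ {p k} → IsH~ _≤P_ p k → 1 ≤ k
  IsH~⇒1≤ {p} (_ , maximal) = maximal (p ∷ []) [-] refl

  IsH-strictMono : ∀ {x y a b} → Strict _≤P_ x y → IsH _≤P_ x a → IsH _≤P_ y b → a < b
  IsH-strictMono {y = y} {b = b} x<y ((c , c-chain , last-c , refl) , _) (_ , maximal) =
    subst (_≤ b) (length-∷ʳ c y) (maximal (c ∷ʳ y) (IsChain-∷ʳ c-chain last-c x<y) (last-∷ʳ c y))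

  IsH~-strictAnti : ∀ {x y a b} → Strict _≤P_ x y → IsH~ _≤P_ x a → IsH~ _≤P_ y b → b < a
  IsH~-strictAnti {x} x<y (_ , maximal) ((y ∷ c , c-chain , refl , refl) , _) =
    maximal (x ∷ y ∷ c) (x<y ∷ c-chain) refl

  lowLabeling-strict : ∀ (m : ℤ) (h~ : Fin n → ℕ) → (∀ p → IsH~ _≤P_ p (h~ p)) →
                       StrictLabeling _≤P_ (λ x → m ℤ.- ℤ.+ h~ x)
  lowLabeling-strict m h~ H~ x y x<y = i-m<i-n m (IsH~-strictAnti x<y (H~ x) (H~ y))

  highLabeling-strict : ∀ (M : ℤ) (h : Fin n → ℕ) → (∀ p → IsH _≤P_ p (h p)) →
                        StrictLabeling _≤P_ (λ x → M ℤ.+ ℤ.+ h x)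
  highLabeling-strict M h H x y x<y = i+m<i+n M (IsH-strictMono x<y (H x) (H y))

open Heights

module Slice {n : ℕ} (_≤P_ : Fin n → Fin n → Set) (ℓ : ℕ) (u v : Fin n → ℕ)
  (v-mono : ∀ p₁ p₂ → p₁ ≤P p₂ → v p₁ ≤ v p₂) (u-anti : ∀ p₁ p₂ → p₁ ≤P p₂ → u p₂ ≤ u p₁)
  (R : Fin n → List ℤ) (h h~ : Fin n → ℕ)
  (H : ∀ p → IsH _≤P_ p (h p)) (H~ : ∀ p → IsH~ _≤P_ p (h~ p))
  (m M : ℤ) (min-R : IsMinUnion R m) (max-R : IsMaxUnion R M)
  (g : Fin n → ℕ → ℤ) (g-labeling : IsPStrictLabeling _≤P_ ℓ u v R g) (i : ℕ) where

  data Position (x : Fin n) : Set where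
    below  : i ≤ u x → Position x
    inside : InDom ℓ u v x i → Position x
    above  : u x < i → ℓ < i + v x → Position x

  position : ∀ x → Position x
  position x with i ℕ.≤? u x
  ... | yes i≤u = below i≤u
  ... | no i≰u with i + v x ℕ.≤? ℓ
  ...   | yes fits = inside (ℕ.≰⇒> i≰u , fits)
  ...   | no overflows = above (ℕ.≰⇒> i≰u) (ℕ.≰⇒> overflows)

  value : ∀ x → Position x → ℤ
  value x (below _)   = m ℤ.- ℤ.+ h~ x
  value x (inside _)  = g x i
  value x (above _ _) = M ℤ.+ ℤ.+ h x

  f : Fin n → ℤ
  f x = value x (position x)

  not-below-upward : ∀ {x y} → Strict _≤P_ x y → u x < i → i ≤ u y → ⊥
  not-below-upward {x} {y} (x≤y , _) u<i i≤u =
    ℕ.<-irrefl refl (ℕ.<-≤-trans u<i (ℕ.≤-trans i≤u (u-anti x y x≤y)))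

  not-inside-upward : ∀ {x y} → Strict _≤P_ x y → ℓ < i + v x → i + v y ≤ ℓ → ⊥
  not-inside-upward {x} {y} (x≤y , _) overflows fits =
    ℕ.<-irrefl refl (ℕ.<-≤-trans overflows (ℕ.≤-trans (ℕ.+-monoʳ-≤ i (v-mono x y x≤y)) fits))

  g-strict : ∀ p₁ p₂ i → InDom ℓ u v p₁ i → InDom ℓ u v p₂ i →
             Strict _≤P_ p₁ p₂ → g p₁ i ℤ.< g p₂ i
  g-strict = proj₁ g-labeling

  g∈R : ∀ p i → InDom ℓ u v p i → g p i ∈ R p
  g∈R = proj₂ (proj₂ g-labeling)

  below<R : ∀ x {y k} → k ∈ R y → m ℤ.- ℤ.+ h~ x ℤ.< k
  below<R x {y} k∈ = ℤ.<-≤-trans (i-n<i m (IsH~⇒1≤ (H~ x))) (proj₂ min-R y _ k∈)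

  R<above : ∀ y {x k} → k ∈ R x → k ℤ.< M ℤ.+ ℤ.+ h y
  R<above y {x} k∈ = ℤ.≤-<-trans (proj₂ max-R x _ k∈) (i<i+n M (IsH⇒1≤ (H y)))

  f-strict : StrictLabeling _≤P_ f
  f-strict x y x<y with position x | position y
  ... | below _      | below _      = lowLabeling-strict m h~ H~ x y x<y
  ... | below _      | inside y∈    = below<R x (g∈R y i y∈)
  ... | below _      | above _ _    =
    let (_ , m∈) = proj₁ min-R in ℤ.<-trans (below<R x m∈) (R<above y m∈)
  ... | inside x∈    | below i≤u    = ⊥-elim (not-below-upward x<y (proj₁ x∈) i≤u)
  ... | inside x∈    | inside y∈    = g-strict x y i x∈ y∈ x<y
  ... | inside x∈    | above _ _    = R<above y (g∈R x i x∈)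
  ... | above u<i _  | below i≤u    = ⊥-elim (not-below-upward x<y u<i i≤u)
  ... | above _ over | inside y∈    = ⊥-elim (not-inside-upward x<y over (proj₂ y∈))
  ... | above _ _    | above _ _    = highLabeling-strict M h H x y x<y

  f∈Rhat : ∀ x → f x ∈ Rhat R m M h h~ x
  f∈Rhat x with position x
  ... | below _   = here refl
  ... | inside x∈ = there (there (g∈R x i x∈))
  ... | above _ _ = there (here refl)

  f-extends : ∀ p → InDom ℓ u v p i → f p ≡ g p i
  f-extends p p∈ with position p
  ... | below i≤u     = ⊥-elim (ℕ.<-irrefl refl (ℕ.<-≤-trans (proj₁ p∈) i≤u))
  ... | inside _      = refl
  ... | above _ over  = ⊥-elim (ℕ.<-irrefl refl (ℕ.<-≤-trans over (proj₂ p∈)))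

proposition2p5 : (n : ℕ) (_≤P_ : Fin n → Fin n → Set) → IsPartialOrder _≡_ _≤P_ →
    (ℓ : ℕ) → 0 < ℓ →
    (u v : Fin n → ℕ) → (∀ p → u p ≤ ℓ) → (∀ p → v p ≤ ℓ) → (∀ p → u p + v p ≤ ℓ) →
    (∀ p₁ p₂ → p₁ ≤P p₂ → v p₁ ≤ v p₂) → (∀ p₁ p₂ → p₁ ≤P p₂ → u p₂ ≤ u p₁) →
    (R : Fin n → List ℤ) → (∀ p → R p ≢ []) →
    IsConsistentPL _≤P_ ℓ u v R →
    (h h~ : Fin n → ℕ) → (∀ p → IsH _≤P_ p (h p)) → (∀ p → IsH~ _≤P_ p (h~ p)) →
    (m M : ℤ) → IsMinUnion R m → IsMaxUnion R M →
    IsConsistentP _≤P_ (Rhat R m M h h~)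
proposition2p5 n _≤P_ _ ℓ _ u v _ _ _ v-mono u-anti R _ consistent h h~ H H~ m M min-R max-R p k k∈
  with k∈
... | here refl =
  (λ x → m ℤ.- ℤ.+ h~ x) , lowLabeling-strict m h~ H~ , (λ _ → here refl) , refl
... | there (here refl) =
  (λ x → M ℤ.+ ℤ.+ h x) , highLabeling-strict M h H , (λ _ → there (here refl)) , refl
... | there (there k∈R) =
  let (g , g-labeling , i , p∈ , g≡k) = consistent p k k∈R
      open Slice _≤P_ ℓ u v v-mono u-anti R h h~ H H~ m M min-R max-R g g-labeling i
  in f , f-strict , f∈Rhat , trans (f-extends p p∈) g≡k
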